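{- Let $\vec G=(V,E,w)$ be a weighted directed graph and suppose $\vec H$ is an $\epsilon$-degree balance preserving directed spectral approximation of $\vec G$. For any subset $W\subseteq V$, let $\vec G'$ and $\vec H'$ be the directed graphs obtained from $\vec G$ and $\vec H$ respectively by contracting $W$. Then $\vec H'$ is an $\epsilon$-degree balance preserving directed spectral approximation of $\vec G'$.
   Context: For an edge $e=(u,v)$, $h(e)=u$, $t(e)=v$; $B=H-T$ with $H_{e,h(e)}=1$, $T_{e,t(e)}=1$, zeros elsewhere; $W_w=\mathrm{diag}(w)$. Directed Laplacian $\vec L_{\vec G}=B^\top W_wH$; $G=\mathrm{und}(\vec G)$ forgets orientations, with Laplacian $L_G=B^\top W_wB$. $\vec H$ on $V$ is an $\epsilon$-degree balance preserving directed spectral approximation of $\vec G$ if for all $x,y\in\mathbb R^V$, $|x^\top(\vec L_{\vec G}-\vec L_{\vec H})y|\le\epsilon\sqrt{x^\top L_Gx\cdot y^\top L_Gy}$. Contracting $W$ replaces all vertices of $W$ by a single new vertex $w$: each edge $(x,u)$ with $x\in W$, $u\notin W$ becomes $(w,u)$, each $(u,x)$ becomes $(u,w)$, parallel edges have their weights summed, and edges with both endpoints in $W$ are discarded. -}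

module Defs where

open import Data.Nat using (ℕ; zero; suc)
open import Data.Fin using (Fin; zero; suc; _≟_)
open import Data.Vec using (Vec; []; _∷_)
open import Data.Bool using (Bool; true; false)
open import Data.Sum using (_⊎_)
open import Data.Product using (∃; _×_; _,_)
open import Relation.Binary.PropositionalEquality using (_≡_; _≢_)
open import Relation.Nullary using (yes; no)

-- The real numbers, given axiomatically as a complete ordered field
-- (any two such structures are isomorphic, so quantifying over all of
-- them is the same as working in ℝ).

record RealField : Set₁ where
  infixl 6 _+_ _-_
  infixl 7 _*_
  infix 4 _≤_
  field
    ℝ    : Set
    0# 1# : ℝ
    _+_ _*_ : ℝ → ℝ → ℝ
    -_   : ℝ → ℝ
    _≤_  : ℝ → ℝ → Set
    +-assoc     : ∀ x y z → (x + y) + z ≡ x + (y + z)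
    +-comm      : ∀ x y → x + y ≡ y + x
    +-identityˡ : ∀ x → 0# + x ≡ x
    +-inverseˡ  : ∀ x → (- x) + x ≡ 0#
    *-assoc     : ∀ x y z → (x * y) * z ≡ x * (y * z)
    *-comm      : ∀ x y → x * y ≡ y * x
    *-identityˡ : ∀ x → 1# * x ≡ x
    distribˡ    : ∀ x y z → x * (y + z) ≡ x * y + x * z
    0≢1         : 0# ≢ 1#
    *-inverse   : ∀ x → x ≢ 0# → ∃ λ y → x * y ≡ 1#
    ≤-refl      : ∀ x → x ≤ x
    ≤-trans     : ∀ {x y z} → x ≤ y → y ≤ z → x ≤ z
    ≤-antisym   : ∀ {x y} → x ≤ y → y ≤ x → x ≡ y
    ≤-total     : ∀ x y → (x ≤ y) ⊎ (y ≤ x)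
    +-mono-≤    : ∀ {x y} z → x ≤ y → x + z ≤ y + z
    *-nonneg    : ∀ {x y} → 0# ≤ x → 0# ≤ y → 0# ≤ x * y
    sup : (P : ℝ → Set) → ∃ P → ∃ (λ b → ∀ x → P x → x ≤ b) →
          ∃ λ s → (∀ x → P x → x ≤ s) × (∀ b → (∀ x → P x → x ≤ b) → s ≤ b)

  _-_ : ℝ → ℝ → ℝ
  x - y = x + (- y)

  AbsLe : ℝ → ℝ → Set
  AbsLe a c = (a ≤ c) × ((- a) ≤ c)

-- A graph is given by its weight function w : V → V → ℝ; the edge set is
-- E = {(u,v) | w u v > 0} (hypotheses on nonnegativity / absence of
-- self-loops are stated separately).

module Graphs (R : RealField) where
  open RealField R

  Σ : ∀ {n} → (Fin n → ℝ) → ℝ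
  Σ {zero}  f = 0#
  Σ {suc n} f = f zero + Σ (λ i → f (suc i))

  WDigraph : ℕ → Set
  WDigraph n = Fin n → Fin n → ℝ

  IsWDigraph : ∀ {n} → WDigraph n → Set
  IsWDigraph {n} w = (∀ u v → 0# ≤ w u v) × (∀ u → w u u ≡ 0#)

  -- x^T (directed Laplacian B^T W H) y = Σ_e w_e (x_{h e} - x_{t e}) y_{h e}
  -- (edges of weight 0 contribute nothing)
  dirForm : ∀ {n} → WDigraph n → (Fin n → ℝ) → (Fin n → ℝ) → ℝ
  dirForm w x y = Σ λ u → Σ λ v → w u v * ((x u - x v) * y u)

  -- x^T (undirected Laplacian B^T W B) y = Σ_e w_e (x_h - x_t)(y_h - y_t)
  undForm : ∀ {n} → WDigraph n → (Fin n → ℝ) → (Fin n → ℝ) → ℝ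
  undForm w x y = Σ λ u → Σ λ v → w u v * ((x u - x v) * (y u - y v))

  -- H is an ε-degree balance preserving directed spectral approximation
  -- of G:  |x^T(L_G⃗ - L_H⃗)y| ≤ ε √(x^T L_G x) √(y^T L_G y) for all x y.
  -- The square roots are expressed as the (unique) nonnegative s, t with
  -- s² = x^T L_G x, t² = y^T L_G y.
  DBPApprox : ∀ {n} → ℝ → WDigraph n → WDigraph n → Set
  DBPApprox {n} ε G H =
    (x y : Fin n → ℝ) (s t : ℝ) →
    0# ≤ s → s * s ≡ undForm G x x →
    0# ≤ t → t * t ≡ undForm G y y →
    AbsLe (dirForm G x y - dirForm H x y) (ε * (s * t))

-- Contraction of a vertex subset W ⊆ Fin n (W i = true iff i ∈ W).
-- The new vertex set is Fin (suc (nout W)): vertex zero is the new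
-- vertex w, and the vertices outside W keep their relative order.

nout : ∀ {n} → Vec Bool n → ℕ
nout []           = zero
nout (true ∷ W)   = nout W
nout (false ∷ W)  = suc (nout W)

private
  lift : ∀ {k} → Fin (suc k) → Fin (suc (suc k))
  lift zero    = zero
  lift (suc i) = suc (suc i)

π : ∀ {n} (W : Vec Bool n) → Fin n → Fin (suc (nout W))
π (true ∷ W)  zero    = zero
π (false ∷ W) zero    = suc zero
π (true ∷ W)  (suc v) = π W v
π (false ∷ W) (suc v) = lift (π W v)

module Contraction (R : RealField) where
  open RealField R
  open Graphs R

  private
    indicator : ∀ {m} → Fin m → Fin m → ℝ → ℝ
    indicator a b r with a ≟ b
    ... | yes _ = r
    ... | no  _ = 0#

  -- w'(a,b) = sum of weights of edges (u,v) with π u = a, π v = b,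
  -- for a ≠ b; edges with both endpoints in W (a = b = w) are discarded.
  contract : ∀ {n} (W : Vec Bool n) → WDigraph n → WDigraph (suc (nout W))
  contract W w a b with a ≟ b
  ... | yes _ = 0#
  ... | no  _ = Σ λ u → Σ λ v → indicator (π W u) a (indicator (π W v) b (w u v))

{-# OPTIONS --safe #-}
-- Off the diagonal, the contracted weights are the pushforward of the weights
-- along the quotient map π.  Every summand of the directed and of the
-- undirected form vanishes on loops, so for x, y on the contracted vertex set
-- both forms of a contracted graph equal the forms of the original graph at
-- x ∘ π and y ∘ π.  The approximation inequality for the contracted graphs is
-- then the one for G and H at these pulled-back vectors.
module Submission where

open import Defs
open import Data.Nat using (ℕ; zero; suc)
open import Data.Bool using (Bool)
open import Data.Vec using (Vec; []; _∷_)
open import Data.Fin using (Fin; zero; suc; _≟_; punchIn)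
open import Data.Fin.Properties using (punchInᵢ≢i)
open import Function using (_∘_)
open import Level using (0ℓ)
open import Algebra.Bundles using (CommutativeRing)
open import Algebra.Consequences.Propositional using (comm∧idˡ⇒id; comm∧invˡ⇒inv; comm∧distrˡ⇒distr)
open import Relation.Binary.PropositionalEquality
open import Relation.Nullary using (yes; no; contradiction)

commutativeRing : RealField → CommutativeRing 0ℓ 0ℓ
commutativeRing R = record
  { Carrier           = ℝ
  ; _≈_               = _≡_
  ; _+_               = _+_
  ; _*_               = _*_
  ; -_                = -_
  ; 0#                = 0#
  ; 1#                = 1#
  ; isCommutativeRing = record
    { isRing = record
      { +-isAbelianGroup = record
        { isGroup = record
          { isMonoid = record
            { isSemigroup = record
              { isMagma = record { isEquivalence = isEquivalence ; ∙-cong = cong₂ _+_ }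
              ; assoc   = +-assoc
              }
            ; identity = comm∧idˡ⇒id +-comm +-identityˡ
            }
          ; inverse = comm∧invˡ⇒inv +-comm +-inverseˡ
          ; ⁻¹-cong = cong (-_)
          }
        ; comm = +-comm
        }
      ; *-cong     = cong₂ _*_
      ; *-assoc    = *-assoc
      ; *-identity = comm∧idˡ⇒id *-comm *-identityˡ
      ; distrib    = comm∧distrˡ⇒distr (cong₂ _+_) *-comm distribˡ
      }
    ; *-comm = *-comm
    }
  }
  where open RealField R

module ContractedForms (R : RealField) where
  open RealField R
  open Graphs R
  open Contraction R
  open CommutativeRing (commutativeRing R) using (semiring; +-identityʳ; -‿inverseʳ; zeroˡ; zeroʳ)
  open import Algebra.Properties.Semiring.Sum semiring
    using (sum; sum-syntax; sum-cong-≗; sum-remove; sum-replicate-zero; ∑-comm; *-distribʳ-sum)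
  open ≡-Reasoning

  Σ≡sum : ∀ {n} (f : Fin n → ℝ) → Σ f ≡ sum f
  Σ≡sum {zero}  f = refl
  Σ≡sum {suc n} f = cong (f zero +_) (Σ≡sum (f ∘ suc))

  Σ-cong : ∀ {n} {f g : Fin n → ℝ} → (∀ i → f i ≡ g i) → Σ f ≡ Σ g
  Σ-cong {zero}  f≗g = refl
  Σ-cong {suc n} f≗g = cong₂ _+_ (f≗g zero) (Σ-cong (f≗g ∘ suc))

  Σ-Σ≡sum-sum : ∀ {m n} (f : Fin m → Fin n → ℝ) →
                Σ (λ u → Σ (f u)) ≡ ∑[ u < m ] ∑[ v < n ] f u v
  Σ-Σ≡sum-sum f = trans (Σ≡sum (λ u → Σ (f u))) (sum-cong-≗ λ u → Σ≡sum (f u))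

  -- `Contraction` keeps the indicator used by `contract` private.  Unfolding
  -- `contract` at variable arguments in `pin` makes unification solve ι as
  -- that very function, so `contract` and `pushforward` agree by refl.
  indicator : ∀ {k} → Fin (suc k) → Fin (suc k) → ℝ → ℝ
  indicator = ι
    where
    ι : ∀ {k} → Fin (suc k) → Fin (suc k) → ℝ → ℝ
    ι = _

    pin : (x : Bool) (w : WDigraph 1) (a b : Fin (suc (nout (x ∷ [])))) →
          contract (x ∷ []) w a b ≡ contract (x ∷ []) w a b
    pin x w a b with a ≟ b
    ... | yes _ = refl
    ... | no _ with nout (x ∷ []) | π (x ∷ []) zero | w zero zero
    ... | k | i | r with i ≟ b
    ... | no _  = refl
    ... | yes _ = refl {x = ι i a r + 0# + 0#}

  indicator-same : ∀ {k} (i : Fin (suc k)) r → indicator i i r ≡ r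
  indicator-same i r with i ≟ i
  ... | yes _  = refl
  ... | no i≢i = contradiction refl i≢i

  indicator-distinct : ∀ {k} {i a : Fin (suc k)} r → i ≢ a → indicator i a r ≡ 0#
  indicator-distinct {i = i} {a} r i≢a with i ≟ a
  ... | yes i≡a = contradiction i≡a i≢a
  ... | no _    = refl

  indicator-*ʳ : ∀ {k} (i a : Fin (suc k)) r c → indicator i a r * c ≡ indicator i a (r * c)
  indicator-*ʳ i a r c with i ≟ a
  ... | yes _ = refl
  ... | no _  = zeroˡ c

  sum-indicator : ∀ {k} (i : Fin (suc k)) (h : Fin (suc k) → ℝ) →
                  ∑[ a < suc k ] indicator i a (h a) ≡ h i
  sum-indicator {k} i h = begin
    ∑[ a < suc k ] indicator i a (h a)
      ≡⟨ sum-remove {i = i} (λ a → indicator i a (h a)) ⟩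
    indicator i i (h i) + ∑[ j < k ] indicator i (punchIn i j) (h (punchIn i j))
      ≡⟨ cong₂ _+_ (indicator-same i (h i)) others-vanish ⟩
    h i + 0#
      ≡⟨ +-identityʳ (h i) ⟩
    h i ∎
    where
    others-vanish : ∑[ j < k ] indicator i (punchIn i j) (h (punchIn i j)) ≡ 0#
    others-vanish = trans (sum-cong-≗ λ j → indicator-distinct _ (punchInᵢ≢i i j ∘ sym))
                          (sum-replicate-zero k)

  sum₂-indicator : ∀ {k} (i j : Fin (suc k)) (g : Fin (suc k) → Fin (suc k) → ℝ) →
                   ∑[ a < suc k ] ∑[ b < suc k ] indicator i a (indicator j b (g a b)) ≡ g i j
  sum₂-indicator {k} i j g = begin
    ∑[ a < suc k ] ∑[ b < suc k ] indicator i a (indicator j b (g a b))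
      ≡⟨ ∑-comm (λ a b → indicator i a (indicator j b (g a b))) ⟩
    ∑[ b < suc k ] ∑[ a < suc k ] indicator i a (indicator j b (g a b))
      ≡⟨ sum-cong-≗ (λ b → sum-indicator i (λ a → indicator j b (g a b))) ⟩
    ∑[ b < suc k ] indicator j b (g i b)
      ≡⟨ sum-indicator j (g i) ⟩
    g i j ∎

  sum₂-comm : ∀ {m n} (f : Fin m → Fin m → Fin n → Fin n → ℝ) →
              ∑[ a < m ] ∑[ b < m ] ∑[ u < n ] ∑[ v < n ] f a b u v ≡
              ∑[ u < n ] ∑[ v < n ] ∑[ a < m ] ∑[ b < m ] f a b u v
  sum₂-comm {m} {n} f = begin
    ∑[ a < m ] ∑[ b < m ] ∑[ u < n ] ∑[ v < n ] f a b u v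
      ≡⟨ sum-cong-≗ (λ a → ∑-comm (λ b u → ∑[ v < n ] f a b u v)) ⟩
    ∑[ a < m ] ∑[ u < n ] ∑[ b < m ] ∑[ v < n ] f a b u v
      ≡⟨ sum-cong-≗ (λ a → sum-cong-≗ λ u → ∑-comm (λ b v → f a b u v)) ⟩
    ∑[ a < m ] ∑[ u < n ] ∑[ v < n ] ∑[ b < m ] f a b u v
      ≡⟨ ∑-comm (λ a u → ∑[ v < n ] ∑[ b < m ] f a b u v) ⟩
    ∑[ u < n ] ∑[ a < m ] ∑[ v < n ] ∑[ b < m ] f a b u v
      ≡⟨ sum-cong-≗ (λ u → ∑-comm (λ a v → ∑[ b < m ] f a b u v)) ⟩
    ∑[ u < n ] ∑[ v < n ] ∑[ a < m ] ∑[ b < m ] f a b u v ∎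

  pushforward : ∀ {n k} → (Fin n → Fin (suc k)) → WDigraph n → WDigraph (suc k)
  pushforward p w a b = Σ λ u → Σ λ v → indicator (p u) a (indicator (p v) b (w u v))

  edgeSum : ∀ {n} → WDigraph n → (Fin n → Fin n → ℝ) → ℝ
  edgeSum w F = Σ λ u → Σ λ v → w u v * F u v

  pushforward≡sum : ∀ {n k} (p : Fin n → Fin (suc k)) (w : WDigraph n) a b →
                    pushforward p w a b ≡ ∑[ u < n ] ∑[ v < n ] indicator (p u) a (indicator (p v) b (w u v))
  pushforward≡sum p w a b = Σ-Σ≡sum-sum (λ u v → indicator (p u) a (indicator (p v) b (w u v)))

  edgeSum≡sum : ∀ {n} (w : WDigraph n) (F : Fin n → Fin n → ℝ) →
                edgeSum w F ≡ ∑[ u < n ] ∑[ v < n ] (w u v * F u v)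
  edgeSum≡sum w F = Σ-Σ≡sum-sum (λ u v → w u v * F u v)

  edgeSum-pushforward : ∀ {n k} (p : Fin n → Fin (suc k)) (w : WDigraph n)
                        (F : Fin (suc k) → Fin (suc k) → ℝ) →
                        edgeSum (pushforward p w) F ≡ edgeSum w (λ u v → F (p u) (p v))
  edgeSum-pushforward {n} {k} p w F = begin
    edgeSum (pushforward p w) F
      ≡⟨ edgeSum≡sum (pushforward p w) F ⟩
    ∑[ a < suc k ] ∑[ b < suc k ] (pushforward p w a b * F a b)
      ≡⟨ sum-cong-≗ (λ a → sum-cong-≗ λ b → pull-in a b) ⟩
    ∑[ a < suc k ] ∑[ b < suc k ] ∑[ u < n ] ∑[ v < n ] indicator (p u) a (indicator (p v) b (w u v * F a b))
      ≡⟨ sum₂-comm (λ a b u v → indicator (p u) a (indicator (p v) b (w u v * F a b))) ⟩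
    ∑[ u < n ] ∑[ v < n ] ∑[ a < suc k ] ∑[ b < suc k ] indicator (p u) a (indicator (p v) b (w u v * F a b))
      ≡⟨ sum-cong-≗ (λ u → sum-cong-≗ λ v → sum₂-indicator (p u) (p v) (λ a b → w u v * F a b)) ⟩
    ∑[ u < n ] ∑[ v < n ] (w u v * F (p u) (p v))
      ≡⟨ edgeSum≡sum w (λ u v → F (p u) (p v)) ⟨
    edgeSum w (λ u v → F (p u) (p v)) ∎
    where
    pull-in : ∀ a b → pushforward p w a b * F a b ≡
              ∑[ u < n ] ∑[ v < n ] indicator (p u) a (indicator (p v) b (w u v * F a b))
    pull-in a b = begin
      pushforward p w a b * F a b
        ≡⟨ cong (_* F a b) (pushforward≡sum p w a b) ⟩
      (∑[ u < n ] ∑[ v < n ] indicator (p u) a (indicator (p v) b (w u v))) * F a b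
        ≡⟨ *-distribʳ-sum (F a b) (λ u → ∑[ v < n ] indicator (p u) a (indicator (p v) b (w u v))) ⟩
      ∑[ u < n ] (∑[ v < n ] indicator (p u) a (indicator (p v) b (w u v)) * F a b)
        ≡⟨ sum-cong-≗ (λ u → *-distribʳ-sum (F a b) λ v → indicator (p u) a (indicator (p v) b (w u v))) ⟩
      ∑[ u < n ] ∑[ v < n ] (indicator (p u) a (indicator (p v) b (w u v)) * F a b)
        ≡⟨ sum-cong-≗ (λ u → sum-cong-≗ λ v → trans (indicator-*ʳ (p u) a _ (F a b))
                                                    (cong (indicator (p u) a) (indicator-*ʳ (p v) b _ (F a b)))) ⟩
      ∑[ u < n ] ∑[ v < n ] indicator (p u) a (indicator (p v) b (w u v * F a b)) ∎

  edgeSum-contract : ∀ {n} (W : Vec Bool n) (G : WDigraph n)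
                     (F : Fin (suc (nout W)) → Fin (suc (nout W)) → ℝ) → (∀ a → F a a ≡ 0#) →
                     edgeSum (contract W G) F ≡ edgeSum G (λ u v → F (π W u) (π W v))
  edgeSum-contract W G F F-diag =
    trans (Σ-cong λ a → Σ-cong λ b → summands-agree a b) (edgeSum-pushforward (π W) G F)
    where
    summands-agree : ∀ a b → contract W G a b * F a b ≡ pushforward (π W) G a b * F a b
    summands-agree a b with a ≟ b
    ... | yes refl = trans (zeroˡ (F a a))
                           (sym (trans (cong (pushforward (π W) G a a *_) (F-diag a)) (zeroʳ _)))
    ... | no _     = refl

  dirForm-contract : ∀ {n} (W : Vec Bool n) (G : WDigraph n) (x y : Fin (suc (nout W)) → ℝ) →
                     dirForm (contract W G) x y ≡ dirForm G (x ∘ π W) (y ∘ π W)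
  dirForm-contract W G x y = edgeSum-contract W G (λ a b → (x a - x b) * y a) λ a →
    trans (cong (_* y a) (-‿inverseʳ (x a))) (zeroˡ (y a))

  undForm-contract : ∀ {n} (W : Vec Bool n) (G : WDigraph n) (x y : Fin (suc (nout W)) → ℝ) →
                     undForm (contract W G) x y ≡ undForm G (x ∘ π W) (y ∘ π W)
  undForm-contract W G x y = edgeSum-contract W G (λ a b → (x a - x b) * (y a - y b)) λ a →
    trans (cong (_* (y a - y a)) (-‿inverseʳ (x a))) (zeroˡ (y a - y a))

lemma3p9 : (R : RealField) (n : ℕ) (G H : Graphs.WDigraph R n) (ε : RealField.ℝ R) →
           Graphs.IsWDigraph R G → Graphs.IsWDigraph R H →
           Graphs.DBPApprox R ε G H →
           (W : Vec Bool n) →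
           Graphs.DBPApprox R ε (Contraction.contract R W G) (Contraction.contract R W H)
lemma3p9 R n G H ε _ _ approx W x y s t 0≤s s²≡ 0≤t t²≡ =
  subst (λ d → AbsLe d (ε * (s * t)))
        (sym (cong₂ _-_ (dirForm-contract W G x y) (dirForm-contract W H x y)))
        (approx (x ∘ π W) (y ∘ π W) s t 0≤s (trans s²≡ (undForm-contract W G x x))
                                        0≤t (trans t²≡ (undForm-contract W G y y)))
  where
  open RealField R
  open ContractedForms R
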